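{- Let $G$ be a connected simple graph that is not isomorphic to any of the graphs $K_{2,l}$ ($l \geq 2$), $W_4$, $E_2 \vee C_4$, $2K_2$, $P_5$, the hammer, and the butterfly. Then $G$ is split if and only if $G/e$ is split for every $e \in E(G)$.
   Context: A graph $G$ is split if $V(G)$ can be partitioned into a clique $K$ and an independent set $S$. $C_n$, $E_n$ denote the cycle and edgeless graph on $n$ vertices; $K_{2,l}$ is the complete bipartite graph with parts of sizes $2$ and $l$; $G\vee H$ is obtained from disjoint $G\cup H$ by adding all edges between $V(G)$ and $V(H)$; $W_4=K_1\vee C_4$. $2K_2$ is the graph consisting of two vertex-disjoint edges; $P_5$ is the path on $5$ vertices. The hammer is the graph on vertices $a,b,x,c,d$ with edges $ab, bx, xc, cd, dx$. The butterfly is the graph on $5$ vertices consisting of two triangles sharing exactly one vertex. For an edge $e=uv$, the graph $G/e$ is obtained from $G$ by adding an edge between $u$ and every neighbour of $v$, then deleting $v$, removing loops and replacing multiple edges by single edges. -}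

module Defs where

open import Data.Nat using (ℕ; zero; suc; pred; _≡ᵇ_; _<ᵇ_)
open import Data.Fin using (Fin; toℕ; punchIn; _≟_)
open import Data.Bool using (Bool; true; false; _∧_; _∨_; _xor_; if_then_else_)
open import Data.List using (List; []; _∷_)
open import Data.Bool.ListAction using (any)
open import Data.Product using (Σ; _×_; _,_; ∃)
open import Relation.Nullary using (¬_; does)
open import Relation.Binary.PropositionalEquality using (_≡_; _≢_)

Graph : ℕ → Set
Graph n = Fin n → Fin n → Bool

record SimpleGraph (n : ℕ) : Set where
  field
    adj   : Graph n
    irrefl : ∀ u → adj u u ≡ false
    sym    : ∀ u v → adj u v ≡ adj v u
open SimpleGraph public

data Reach {n : ℕ} (A : Graph n) : Fin n → Fin n → Set where
  here : ∀ {u} → Reach A u u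
  step : ∀ {u v w} → A u v ≡ true → Reach A v w → Reach A u w

Connected : ∀ {n} → Graph n → Set
Connected {n} A = ∀ (u v : Fin n) → Reach A u v

IsSplit : ∀ {n} → Graph n → Set
IsSplit {n} A = Σ (Fin n → Bool) λ inK →
  (∀ u v → u ≢ v → inK u ≡ true → inK v ≡ true → A u v ≡ true) ×
  (∀ u v → u ≢ v → inK u ≡ false → inK v ≡ false → A u v ≡ false)

_==_ : ∀ {n} → Fin n → Fin n → Bool
x == y = does (x ≟ y)

-- Contraction G/e for e = uv: join u to every neighbour of v, delete v,
-- remove loops and multiple edges. The vertices of G/e are Fin (n-1),
-- mapped back to V(G) ∖ {v} via punchIn v.
contract : ∀ {n} → Graph n → Fin n → Fin n → Graph (pred n)
contract {suc m} A u v x y =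
  if x == y then false
  else (A a b ∨ ((a == u) ∧ A v b) ∨ ((b == u) ∧ A v a))
  where
    a = punchIn v x
    b = punchIn v y

record Iso {n m : ℕ} (A : Graph n) (B : Graph m) : Set where
  field
    to      : Fin n → Fin m
    from    : Fin m → Fin n
    from∘to : ∀ x → from (to x) ≡ x
    to∘from : ∀ y → to (from y) ≡ y
    preserve : ∀ x y → A x y ≡ B (to x) (to y)

fromEdges : ∀ {n} → List (ℕ × ℕ) → Graph n
fromEdges es x y = any (λ { (i , j) →
  ((toℕ x ≡ᵇ i) ∧ (toℕ y ≡ᵇ j)) ∨ ((toℕ x ≡ᵇ j) ∧ (toℕ y ≡ᵇ i)) }) es

-- K_{2,l}: parts {0,1} and {2,...,l+1}.
K2l : (l : ℕ) → Graph (2 Data.Nat.+ l)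
K2l l x y = (toℕ x <ᵇ 2) xor (toℕ y <ᵇ 2)

W4 : Graph 5
W4 = fromEdges ((0 , 1) ∷ (0 , 2) ∷ (0 , 3) ∷ (0 , 4) ∷
                (1 , 2) ∷ (2 , 3) ∷ (3 , 4) ∷ (4 , 1) ∷ [])

E2∨C4 : Graph 6
E2∨C4 = fromEdges ((0 , 2) ∷ (0 , 3) ∷ (0 , 4) ∷ (0 , 5) ∷
                   (1 , 2) ∷ (1 , 3) ∷ (1 , 4) ∷ (1 , 5) ∷
                   (2 , 3) ∷ (3 , 4) ∷ (4 , 5) ∷ (5 , 2) ∷ [])

2K2 : Graph 4
2K2 = fromEdges ((0 , 1) ∷ (2 , 3) ∷ [])

P5 : Graph 5
P5 = fromEdges ((0 , 1) ∷ (1 , 2) ∷ (2 , 3) ∷ (3 , 4) ∷ [])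

Hammer : Graph 5
Hammer = fromEdges ((0 , 1) ∷ (1 , 2) ∷ (2 , 3) ∷ (3 , 4) ∷ (4 , 2) ∷ [])

Butterfly : Graph 5
Butterfly = fromEdges ((0 , 1) ∷ (1 , 2) ∷ (2 , 0) ∷
                       (0 , 3) ∷ (3 , 4) ∷ (4 , 0) ∷ [])

NotExcluded : ∀ {n} → Graph n → Set
NotExcluded A =
  (∀ (l : ℕ) → 2 Data.Nat.≤ l → ¬ Iso A (K2l l)) ×
  ¬ Iso A W4 × ¬ Iso A E2∨C4 × ¬ Iso A 2K2 × ¬ Iso A P5 ×
  ¬ Iso A Hammer × ¬ Iso A Butterfly

-- A split graph stays split under contraction of an edge uv: the merged vertex takes the side
-- of whichever endpoint lies in the clique. Conversely, by Földes and Hammer a graph that is not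
-- split has an induced 2K₂, C₄ or C₅. Contracting an edge of an induced subgraph gives an induced
-- subgraph of the contraction, so when all contractions of G are split, so are those of every
-- induced subgraph, and this is checked by computation on small graphs. It excludes C₅ at once
-- (C₅/e = C₄), and together with connectivity it pins G down around an induced 2K₂ to P₅, the
-- hammer or the butterfly, and around an induced C₄ to K_{2,l}, W₄ or E₂ ∨ C₄.

module Submission where

open import Defs hiding (sym)
open import Data.Nat as ℕ using (ℕ; zero; suc; _+_; _≤_; _<_; z≤n; s≤s)
open import Data.Nat.Properties
  using (module ≤-Reasoning; ≤-refl; n≮0; ≤-trans; ≤-pred; +-mono-≤; +-mono-<-≤; +-mono-≤-<; +-0-commutativeMonoid)
open import Data.Unit using (⊤; tt)
open import Data.Fin using (Fin; zero; suc; toℕ; punchIn; punchOut; _≟_; #_)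
open import Data.Fin.Permutation as Perm using (Permutation′; _⟨$⟩ʳ_; _⟨$⟩ˡ_; _∘ₚ_; inverseˡ; inverseʳ)
open import Data.Fin.Permutation.Components using (transpose)
open import Data.Fin.Properties
  using (any?; injective⇒≤; 0≢1+n; punchIn-punchOut; punchOut-injective; punchInᵢ≢i; punchIn-injective)
open import Data.Bool as Bool using (Bool; true; false; _∧_; _∨_; _xor_; not; if_then_else_)
open import Data.Bool.Properties
  using (∧-conicalˡ; ∧-conicalʳ; ∨-conicalˡ; ∨-conicalʳ; ∨-identityʳ; ∨-zeroʳ; not-injective; ¬-not)
open import Data.Vec using (Vec; []; _∷_; lookup; map; tabulate; head)
open import Data.Vec.Properties using (lookup-map; lookup∘tabulate; ≡-dec)
open import Data.Vec.Relation.Unary.All using (All; []; _∷_)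
open import Data.Vec.Relation.Unary.AllPairs using ([]; _∷_)
open import Data.Vec.Relation.Unary.Unique.Propositional using (Unique)
open import Data.Vec.Relation.Unary.Unique.Propositional.Properties using (lookup-injective)
open import Data.Product using (_×_; _,_; ∃; ∃₂; proj₁; proj₂)
open import Data.Sum using (_⊎_; inj₁; inj₂; [_,_]′)
open import Data.Empty using (⊥; ⊥-elim)
open import Function using (_∘_; id)
open import Function.Definitions using (Injective)
open import Function.Bundles using (Injection)
open import Function.Properties.Inverse using (↔⇒↣)
open import Relation.Nullary using (¬_; Dec; yes; no; does)
open import Relation.Nullary.Decidable using (dec-true; dec-false; _×-dec_; ¬?)
open import Relation.Binary.PropositionalEquality
open import Algebra.Properties.CommutativeMonoid.Sum +-0-commutativeMonoid using (sum; sum-permute; sum-cong-≗)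

≡true⇒≢false : ∀ {b} → b ≡ true → b ≢ false
≡true⇒≢false refl ()

does⇒ : ∀ {P : Set} (d : Dec P) → does d ≡ true → P
does⇒ (yes p) _ = p

∨-trueˡ : ∀ {a} b → a ≡ true → a ∨ b ≡ true
∨-trueˡ b refl = refl

∨-trueʳ : ∀ a {b} → b ≡ true → a ∨ b ≡ true
∨-trueʳ a refl = ∨-zeroʳ a

∨-resolveˡ : ∀ {a b} → a ∨ b ≡ true → b ≡ false → a ≡ true
∨-resolveˡ {a} a∨b refl = trans (sym (∨-identityʳ a)) a∨b

∨-resolveʳ : ∀ {a b} → a ∨ b ≡ true → a ≡ false → b ≡ true
∨-resolveʳ a∨b refl = a∨b

∨₄-false : ∀ {a b c d} → a ∨ b ∨ c ∨ d ≡ false → a ≡ false × b ≡ false × c ≡ false × d ≡ false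
∨₄-false {false} {false} {false} {false} _ = refl , refl , refl , refl

∧-true : ∀ {a b} → a ∧ b ≡ true → a ≡ true × b ≡ true
∧-true {true} {true} _ = refl , refl

∧₃-true : ∀ {a b c} → a ∧ b ∧ c ≡ true → a ≡ true × b ≡ true × c ≡ true
∧₃-true {true} {true} {true} _ = refl , refl , refl

==-refl : ∀ {n} (x : Fin n) → (x == x) ≡ true
==-refl x = dec-true (x ≟ x) refl

==-≢ : ∀ {n} {x y : Fin n} → x ≢ y → (x == y) ≡ false
==-≢ {x = x} {y} = dec-false (x ≟ y)

==⇒≡ : ∀ {n} {x y : Fin n} → (x == y) ≡ true → x ≡ y
==⇒≡ {x = x} {y} = does⇒ (x ≟ y)

==⇒≢ : ∀ {n} {x y : Fin n} → (x == y) ≡ false → x ≢ y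
==⇒≢ {x = x} {y} eq x≡y = ≡true⇒≢false (dec-true (x ≟ y) x≡y) eq

Homogeneous : ∀ {n} → Graph n → (Fin n → Bool) → Bool → Set
Homogeneous {n} A X b = ∀ (u v : Fin n) → u ≢ v → X u ≡ b → X v ≡ b → A u v ≡ b

IsClique : ∀ {n} → Graph n → (Fin n → Bool) → Set
IsClique A K = Homogeneous A K true

AllContractionsSplit : ∀ {n} → Graph n → Set
AllContractionsSplit {n} A = ∀ (u v : Fin n) → A u v ≡ true → IsSplit (contract A u v)

-- Contraction of an edge

module _ {m} (A : Graph (suc m)) (u v : Fin (suc m)) {x y : Fin m} where

  contract-edge : x ≢ y → A (punchIn v x) (punchIn v y) ≡ true → contract A u v x y ≡ true
  contract-edge x≢y e rewrite ==-≢ x≢y | e = refl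

  contract-mergedˡ : x ≢ y → punchIn v x ≡ u → A v (punchIn v y) ≡ true → contract A u v x y ≡ true
  contract-mergedˡ x≢y refl e rewrite ==-≢ x≢y | ==-refl (punchIn v x) | e = ∨-zeroʳ _

  contract-mergedʳ : x ≢ y → punchIn v y ≡ u → A v (punchIn v x) ≡ true → contract A u v x y ≡ true
  contract-mergedʳ x≢y refl e rewrite ==-≢ x≢y | ==-refl (punchIn v y) | e =
    trans (cong (A (punchIn v x) (punchIn v y) ∨_) (∨-zeroʳ _)) (∨-zeroʳ _)

  contract-nonedge : A (punchIn v x) (punchIn v y) ≡ false → punchIn v x ≢ u → punchIn v y ≢ u → contract A u v x y ≡ false
  contract-nonedge e x≢u y≢u rewrite e | ==-≢ x≢u | ==-≢ y≢u with x == y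
  ... | true = refl
  ... | false = refl

module _ {m} {A : Graph (suc m)} {K : Fin (suc m) → Bool}
         (clique : IsClique A K) (indep : Homogeneous A K false) (u v : Fin (suc m)) where

  private
    punchIn-≢ : ∀ {x y} → x ≢ y → punchIn v x ≢ punchIn v y
    punchIn-≢ x≢y = x≢y ∘ punchIn-injective v _ _

    ≢-by-K : ∀ {a b} → K a ≡ true → K b ≡ false → a ≢ b
    ≢-by-K Ka Kb refl = ≡true⇒≢false Ka Kb

  contract-split-by-K : K u ≡ true → IsSplit (contract A u v)
  contract-split-by-K Ku = K ∘ punchIn v , clique′ , indep′
    where
    clique′ : IsClique (contract A u v) (K ∘ punchIn v)
    clique′ x y x≢y Kx Ky = contract-edge A u v x≢y (clique _ _ (punchIn-≢ x≢y) Kx Ky)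
    indep′ : Homogeneous (contract A u v) (K ∘ punchIn v) false
    indep′ x y x≢y Kx Ky =
      contract-nonedge A u v (indep _ _ (punchIn-≢ x≢y) Kx Ky) (≢-by-K Ku Kx ∘ sym) (≢-by-K Ku Ky ∘ sym)

  -- The merged vertex u joins the clique and inherits the clique edges of v.
  contract-split-by-K′ : K v ≡ true → IsSplit (contract A u v)
  contract-split-by-K′ Kv = K′ , clique′ , indep′
    where
    K′ : Fin m → Bool
    K′ x = K (punchIn v x) ∨ (punchIn v x == u)
    inK : ∀ {x} → K′ x ≡ true → punchIn v x ≢ u → K (punchIn v x) ≡ true
    inK K′x x≢u = ∨-resolveˡ K′x (==-≢ x≢u)
    v-edge : ∀ {x} → K′ x ≡ true → punchIn v x ≢ u → A v (punchIn v x) ≡ true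
    v-edge K′x x≢u = clique _ _ (punchInᵢ≢i v _ ∘ sym) Kv (inK K′x x≢u)
    clique′ : IsClique (contract A u v) K′
    clique′ x y x≢y K′x K′y = merged? (punchIn v x ≟ u) (punchIn v y ≟ u)
      where
      merged? : Dec (punchIn v x ≡ u) → Dec (punchIn v y ≡ u) → contract A u v x y ≡ true
      merged? (yes x≡u) (yes y≡u) = ⊥-elim (punchIn-≢ x≢y (trans x≡u (sym y≡u)))
      merged? (yes x≡u) (no y≢u) = contract-mergedˡ A u v x≢y x≡u (v-edge K′y y≢u)
      merged? (no x≢u) (yes y≡u) = contract-mergedʳ A u v x≢y y≡u (v-edge K′x x≢u)
      merged? (no x≢u) (no y≢u) = contract-edge A u v x≢y (clique _ _ (punchIn-≢ x≢y) (inK K′x x≢u) (inK K′y y≢u))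
    indep′ : Homogeneous (contract A u v) K′ false
    indep′ x y x≢y K′x K′y =
      contract-nonedge A u v (indep _ _ (punchIn-≢ x≢y) (∨-conicalˡ _ _ K′x) (∨-conicalˡ _ _ K′y))
        (==⇒≢ (∨-conicalʳ _ _ K′x)) (==⇒≢ (∨-conicalʳ _ _ K′y))

IsSplit⇒AllContractionsSplit : ∀ {m} (A : Graph (suc m)) → (∀ u → A u u ≡ false) → IsSplit A → AllContractionsSplit A
IsSplit⇒AllContractionsSplit A irr (K , clique , indep) u v uv with K u in Ku | K v in Kv
... | true | _ = contract-split-by-K clique indep u v Ku
... | false | true = contract-split-by-K′ clique indep u v Kv
... | false | false = ⊥-elim (≡true⇒≢false uv (indep u v u≢v Ku Kv))
  where
  u≢v : u ≢ v
  u≢v refl = ≡true⇒≢false uv (irr u)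

contract-cong : ∀ {k n} {C : Graph (suc k)} {A : Graph (suc n)} {i j s t u v x y} →
  (s == t) ≡ (x == y) →
  C (punchIn j s) (punchIn j t) ≡ A (punchIn v x) (punchIn v y) →
  (punchIn j s == i) ≡ (punchIn v x == u) → C j (punchIn j t) ≡ A v (punchIn v y) →
  (punchIn j t == i) ≡ (punchIn v y == u) → C j (punchIn j s) ≡ A v (punchIn v x) →
  contract C i j s t ≡ contract A u v x y
contract-cong e₁ e₂ e₃ e₄ e₅ e₆ rewrite e₁ | e₂ | e₃ | e₄ | e₅ | e₆ = refl

==-injective : ∀ {k n} {f : Fin k → Fin n} → Injective _≡_ _≡_ f → ∀ x y → (f x == f y) ≡ (x == y)
==-injective {f = f} f-inj x y with x ≟ y
... | yes refl = ==-refl (f x)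
... | no x≢y = ==-≢ (x≢y ∘ f-inj)

-- Induced subgraphs

record _↪_ {k n} (C : Graph k) (A : Graph n) : Set where
  field
    embed     : Fin k → Fin n
    injective : Injective _≡_ _≡_ embed
    adj-embed : ∀ i j → C i j ≡ A (embed i) (embed j)
open _↪_

IsSplit-↪ : ∀ {k n} {C : Graph k} {A : Graph n} → C ↪ A → IsSplit A → IsSplit C
IsSplit-↪ {C = C} {A} e (K , clique , indep) = K ∘ embed e , restrict clique , restrict indep
  where
  restrict : ∀ {b} → Homogeneous A K b → Homogeneous C (K ∘ embed e) b
  restrict hom i j i≢j Ki Kj = trans (adj-embed e i j) (hom _ _ (i≢j ∘ injective e) Ki Kj)

contract-↪ : ∀ {k n} {C : Graph (suc k)} {A : Graph (suc n)} (e : C ↪ A) (i j : Fin (suc k)) →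
  contract C i j ↪ contract A (embed e i) (embed e j)
contract-↪ {k} {n} {C} {A} e i j = record { embed = f ; injective = f-inj ; adj-embed = adj-f }
  where
  j≢ : ∀ t → embed e j ≢ embed e (punchIn j t)
  j≢ t = punchInᵢ≢i j t ∘ injective e ∘ sym
  f : Fin k → Fin n
  f t = punchOut (j≢ t)
  punchIn-f : ∀ t → punchIn (embed e j) (f t) ≡ embed e (punchIn j t)
  punchIn-f t = punchIn-punchOut (j≢ t)
  f-inj : Injective _≡_ _≡_ f
  f-inj {s} {t} fs≡ft = punchIn-injective j s t (injective e (punchOut-injective (j≢ s) (j≢ t) fs≡ft))
  adj-f : ∀ s t → contract C i j s t ≡ contract A (embed e i) (embed e j) (f s) (f t)
  adj-f s t = contract-cong {C = C} {A} {i} {j} {s} {t} {embed e i} {embed e j} {f s} {f t}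
    (sym (==-injective f-inj s t))
    (trans (adj-embed e _ _) (sym (cong₂ A (punchIn-f s) (punchIn-f t))))
    (trans (sym (==-injective (injective e) _ _)) (cong (_== embed e i) (sym (punchIn-f s))))
    (trans (adj-embed e _ _) (cong (A (embed e j)) (sym (punchIn-f t))))
    (trans (sym (==-injective (injective e) _ _)) (cong (_== embed e i) (sym (punchIn-f t))))
    (trans (adj-embed e _ _) (cong (A (embed e j)) (sym (punchIn-f s))))

AllContractionsSplit-↪ : ∀ {k n} {C : Graph (suc k)} {A : Graph (suc n)} →
  C ↪ A → AllContractionsSplit A → AllContractionsSplit C
AllContractionsSplit-↪ e split i j Cij =
  IsSplit-↪ (contract-↪ e i j) (split (embed e i) (embed e j) (trans (sym (adj-embed e i j)) Cij))

-- Deciding splitness of small graphs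

allFin : ∀ {k} → (Fin k → Bool) → Bool
allFin {zero} p = true
allFin {suc k} p = p zero ∧ allFin (p ∘ suc)

anyFin : ∀ {k} → (Fin k → Bool) → Bool
anyFin {zero} p = false
anyFin {suc k} p = p zero ∨ anyFin (p ∘ suc)

allFin-sound : ∀ {k} (p : Fin k → Bool) → allFin p ≡ true → ∀ i → p i ≡ true
allFin-sound p all zero = ∧-conicalˡ _ _ all
allFin-sound p all (suc i) = allFin-sound (p ∘ suc) (∧-conicalʳ _ _ all) i

allFin-complete : ∀ {k} (p : Fin k → Bool) → (∀ i → p i ≡ true) → allFin p ≡ true
allFin-complete {zero} p _ = refl
allFin-complete {suc k} p all rewrite all zero = allFin-complete (p ∘ suc) (all ∘ suc)

anyFin-sound : ∀ {k} (p : Fin k → Bool) → anyFin p ≡ true → ∃ λ i → p i ≡ true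
anyFin-sound {suc k} p any with p zero in p0
... | true = zero , p0
... | false with anyFin-sound (p ∘ suc) any
...   | i , pi = suc i , pi

allVec : ∀ k → (Vec Bool k → Bool) → Bool
allVec zero p = p []
allVec (suc k) p = allVec k (p ∘ (true ∷_)) ∧ allVec k (p ∘ (false ∷_))

anyVec : ∀ k → (Vec Bool k → Bool) → Bool
anyVec zero p = p []
anyVec (suc k) p = anyVec k (p ∘ (true ∷_)) ∨ anyVec k (p ∘ (false ∷_))

allVec-sound : ∀ k (p : Vec Bool k → Bool) → allVec k p ≡ true → ∀ bs → p bs ≡ true
allVec-sound zero p all [] = all
allVec-sound (suc k) p all (true ∷ bs) = allVec-sound k _ (∧-conicalˡ _ _ all) bs
allVec-sound (suc k) p all (false ∷ bs) = allVec-sound k _ (∧-conicalʳ _ _ all) bs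

anyVec-complete : ∀ k (p : Vec Bool k → Bool) bs → p bs ≡ true → anyVec k p ≡ true
anyVec-complete zero p [] pbs = pbs
anyVec-complete (suc k) p (true ∷ bs) pbs = ∨-trueˡ _ (anyVec-complete k _ bs pbs)
anyVec-complete (suc k) p (false ∷ bs) pbs = ∨-trueʳ _ (anyVec-complete k _ bs pbs)

respectsᵇ : (inKᵤ inKᵥ adjacent : Bool) → Bool
respectsᵇ true true c = c
respectsᵇ false false c = not c
respectsᵇ _ _ _ = true

isSplitPartitionᵇ : ∀ {k} → Graph k → Vec Bool k → Bool
isSplitPartitionᵇ C K = allFin λ u → allFin λ v → (u == v) ∨ respectsᵇ (lookup K u) (lookup K v) (C u v)

isSplitᵇ : ∀ {k} → Graph k → Bool
isSplitᵇ {k} C = anyVec k (isSplitPartitionᵇ C)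

isSplitᵇ-complete : ∀ {k} (C : Graph k) → IsSplit C → isSplitᵇ C ≡ true
isSplitᵇ-complete {k} C (K , clique , indep) =
  anyVec-complete k _ (tabulate K) (allFin-complete _ λ u → allFin-complete _ λ v → respects u v)
  where
  respects-by : ∀ a b c → (a ≡ true → b ≡ true → c ≡ true) → (a ≡ false → b ≡ false → c ≡ false) →
    respectsᵇ a b c ≡ true
  respects-by true true c h _ = h refl refl
  respects-by false false c _ h rewrite h refl refl = refl
  respects-by true false c _ _ = refl
  respects-by false true c _ _ = refl
  respects : ∀ u v → ((u == v) ∨ respectsᵇ (lookup (tabulate K) u) (lookup (tabulate K) v) (C u v)) ≡ true
  respects u v with u ≟ v
  ... | yes _ = refl
  ... | no u≢v rewrite lookup∘tabulate K u | lookup∘tabulate K v =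
    respects-by (K u) (K v) (C u v) (clique u v u≢v) (indep u v u≢v)

hasNonSplitContractionᵇ : ∀ {k} → Graph (suc k) → Bool
hasNonSplitContractionᵇ C = anyFin λ i → anyFin λ j → C i j ∧ not (isSplitᵇ (contract C i j))

hasNonSplitContractionᵇ-sound : ∀ {k} (C : Graph (suc k)) → hasNonSplitContractionᵇ C ≡ true → ¬ AllContractionsSplit C
hasNonSplitContractionᵇ-sound C bad split with anyFin-sound _ bad
... | i , bad-i with anyFin-sound _ bad-i
...   | j , bad-ij = ≡true⇒≢false (isSplitᵇ-complete _ (split i j (∧-conicalˡ _ _ bad-ij)))
                       (not-injective (∧-conicalʳ _ _ bad-ij))

-- Adjacency tables and isomorphisms

Table : ℕ → Set
Table zero = ⊤
Table (suc k) = Vec Bool k × Table k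

⟦_⟧ : ∀ {k} → Table k → Graph k
⟦_⟧ {suc k} (r , t) zero zero = false
⟦_⟧ {suc k} (r , t) zero (suc j) = lookup r j
⟦_⟧ {suc k} (r , t) (suc i) zero = lookup r i
⟦_⟧ {suc k} (r , t) (suc i) (suc j) = ⟦ t ⟧ i j

table : ∀ {n k} → Graph n → Vec (Fin n) k → Table k
table A [] = tt
table A (x ∷ xs) = map (A x) xs , table A xs

⟦table⟧ : ∀ {n k} (G : SimpleGraph n) (xs : Vec (Fin n) k) →
  ∀ i j → ⟦ table (adj G) xs ⟧ i j ≡ adj G (lookup xs i) (lookup xs j)
⟦table⟧ G (x ∷ xs) zero zero = sym (irrefl G x)
⟦table⟧ G (x ∷ xs) zero (suc j) = lookup-map j (adj G x) xs
⟦table⟧ G (x ∷ xs) (suc i) zero = trans (lookup-map i (adj G x) xs) (SimpleGraph.sym G x (lookup xs i))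
⟦table⟧ G (x ∷ xs) (suc i) (suc j) = ⟦table⟧ G xs i j

table-↪ : ∀ {n k} (G : SimpleGraph n) {xs : Vec (Fin n) k} → Unique xs →
  ∀ {t} → table (adj G) xs ≡ t → ⟦ t ⟧ ↪ adj G
table-↪ G {xs} xs! refl = record
  { embed = lookup xs ; injective = lookup-injective xs! _ _ ; adj-embed = ⟦table⟧ G xs }

_∈ᵇ_ : ∀ {n k} → Fin n → Vec (Fin n) k → Bool
x ∈ᵇ [] = false
x ∈ᵇ (y ∷ ys) = (x == y) ∨ (x ∈ᵇ ys)

∈ᵇ-lookup : ∀ {n k} (xs : Vec (Fin n) k) i → lookup xs i ∈ᵇ xs ≡ true
∈ᵇ-lookup (x ∷ xs) zero rewrite ==-refl x = refl
∈ᵇ-lookup (x ∷ xs) (suc i) = ∨-trueʳ _ (∈ᵇ-lookup xs i)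

∈ᵇ⇒lookup : ∀ {n k} {x : Fin n} (xs : Vec (Fin n) k) → x ∈ᵇ xs ≡ true → ∃ λ i → lookup xs i ≡ x
∈ᵇ⇒lookup {x = x} (y ∷ ys) x∈ with x ≟ y
... | yes x≡y = zero , sym x≡y
... | no _ with ∈ᵇ⇒lookup ys x∈
...   | i , eq = suc i , eq

∉ᵇ⇒All≢ : ∀ {n k} {x : Fin n} (xs : Vec (Fin n) k) → x ∈ᵇ xs ≡ false → All (x ≢_) xs
∉ᵇ⇒All≢ [] _ = []
∉ᵇ⇒All≢ (y ∷ ys) x∉ = ==⇒≢ (∨-conicalˡ _ _ x∉) ∷ ∉ᵇ⇒All≢ ys (∨-conicalʳ _ _ x∉)

∉ᵇ-∷⁻ : ∀ {n k} {x y : Fin n} {ys : Vec (Fin n) k} → x ∈ᵇ (y ∷ ys) ≡ false → x ≢ y × x ∈ᵇ ys ≡ false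
∉ᵇ-∷⁻ {x = x} {y} {ys} x∉ = ==⇒≢ (∨-conicalˡ (x == y) (x ∈ᵇ ys) x∉) , ∨-conicalʳ (x == y) (x ∈ᵇ ys) x∉

∉ᵇ-∷⁺ : ∀ {n k} {x y : Fin n} {ys : Vec (Fin n) k} → x ≢ y → x ∈ᵇ ys ≡ false → x ∈ᵇ (y ∷ ys) ≡ false
∉ᵇ-∷⁺ x≢y x∉ rewrite ==-≢ x≢y = x∉

covering : ∀ {n k} {W : Vec (Fin n) k} → ¬ (∃ λ x → x ∈ᵇ W ≡ false) → ∀ x → x ∈ᵇ W ≡ true
covering none x = ¬-not λ x∉ → none (x , x∉)

Unique-lookup-≢ : ∀ {n k} {xs : Vec (Fin n) k} → Unique xs → ∀ i j → i ≢ j → lookup xs i ≢ lookup xs j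
Unique-lookup-≢ xs! i j i≢j = i≢j ∘ lookup-injective xs! i j

Unique⇒length≤ : ∀ {n k} {xs : Vec (Fin n) k} → Unique xs → k ≤ n
Unique⇒length≤ xs! = injective⇒≤ λ {i} {j} → lookup-injective xs! i j

Unique-∷ : ∀ {n k} {x : Fin n} {xs : Vec (Fin n) k} → x ∈ᵇ xs ≡ false → Unique xs → Unique (x ∷ xs)
Unique-∷ {xs = xs} x∉ xs! = ∉ᵇ⇒All≢ xs x∉ ∷ xs!

Iso-trans : ∀ {n m k} {A : Graph n} {B : Graph m} {C : Graph k} → Iso A B → Iso B C → Iso A C
Iso-trans I J = record
  { to = Iso.to J ∘ Iso.to I
  ; from = Iso.from I ∘ Iso.from J
  ; from∘to = λ x → trans (cong (Iso.from I) (Iso.from∘to J _)) (Iso.from∘to I x)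
  ; to∘from = λ z → trans (cong (Iso.to J) (Iso.to∘from I _)) (Iso.to∘from J z)
  ; preserve = λ x y → trans (Iso.preserve I x y) (Iso.preserve J _ _) }

Iso-table : ∀ {n k} (G : SimpleGraph n) {W : Vec (Fin n) k} → Unique W → (∀ x → x ∈ᵇ W ≡ true) →
  ∀ {t} → table (adj G) W ≡ t → Iso (adj G) ⟦ t ⟧
Iso-table G {W} W! cover refl = record
  { to = to ; from = lookup W ; from∘to = from∘to
  ; to∘from = λ i → lookup-injective W! _ _ (from∘to (lookup W i))
  ; preserve = λ x y → trans (sym (cong₂ (adj G) (from∘to x) (from∘to y))) (sym (⟦table⟧ G W (to x) (to y))) }
  where
  to : Fin _ → Fin _
  to x = proj₁ (∈ᵇ⇒lookup W (cover x))
  from∘to : ∀ x → lookup W (to x) ≡ x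
  from∘to x = proj₂ (∈ᵇ⇒lookup W (cover x))

inverseᵇ : ∀ {k} (p q : Vec (Fin k) k) → Bool
inverseᵇ p q = allFin λ x → lookup q (lookup p x) == x

preservesᵇ : ∀ {k} (C D : Graph k) (p : Vec (Fin k) k) → Bool
preservesᵇ C D p = allFin λ x → allFin λ y → does (C x y Bool.≟ D (lookup p x) (lookup p y))

-- p and q list the images of 0, 1, …, k - 1 under a candidate isomorphism and its inverse.
isIsoᵇ : ∀ {k} (C D : Graph k) (p q : Vec (Fin k) k) → Bool
isIsoᵇ C D p q = inverseᵇ p q ∧ inverseᵇ q p ∧ preservesᵇ C D p

isIsoᵇ-sound : ∀ {k} (C D : Graph k) (p q : Vec (Fin k) k) → isIsoᵇ C D p q ≡ true → Iso C D
isIsoᵇ-sound C D p q iso = record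
  { to = lookup p ; from = lookup q
  ; from∘to = ==⇒≡ ∘ allFin-sound _ (∧-conicalˡ (inverseᵇ p q) _ iso)
  ; to∘from = ==⇒≡ ∘ allFin-sound _ (∧-conicalˡ (inverseᵇ q p) _ rest)
  ; preserve = λ x y → does⇒ (C x y Bool.≟ _) (allFin-sound _ (allFin-sound _ preserves x) y) }
  where
  rest : (inverseᵇ q p ∧ preservesᵇ C D p) ≡ true
  rest = ∧-conicalʳ (inverseᵇ p q) _ iso
  preserves : preservesᵇ C D p ≡ true
  preserves = ∧-conicalʳ (inverseᵇ q p) (preservesᵇ C D p) rest

¬Iso-by : ∀ {n k} {A : Graph n} {C D : Graph k} (p q : Vec (Fin k) k) → isIsoᵇ C D p q ≡ true →
  ¬ Iso A D → ¬ Iso A C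
¬Iso-by p q check ¬D iso = ¬D (Iso-trans iso (isIsoᵇ-sound _ _ p q check))

Iso-permutation : ∀ {n} {A B : Graph n} (π : Permutation′ n) →
  (∀ x y → A x y ≡ B (π ⟨$⟩ʳ x) (π ⟨$⟩ʳ y)) → Iso A B
Iso-permutation π preserve = record
  { to = π ⟨$⟩ʳ_ ; from = π ⟨$⟩ˡ_ ; from∘to = λ _ → inverseˡ π ; to∘from = λ _ → inverseʳ π ; preserve = preserve }

transpose-left : ∀ {n} (i j : Fin n) → transpose i j i ≡ j
transpose-left i j rewrite dec-true (i ≟ i) refl = refl

transpose-right : ∀ {n} (i j : Fin n) → transpose i j j ≡ i
transpose-right i j with j ≟ i
... | yes j≡i = j≡i
... | no _ rewrite dec-true (j ≟ j) refl = refl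

transpose-other : ∀ {n} {i j k : Fin n} → k ≢ i → k ≢ j → transpose i j k ≡ k
transpose-other {i = i} {j} {k} k≢i k≢j rewrite dec-false (k ≟ i) k≢i | dec-false (k ≟ j) k≢j = refl

module _ {m} (G : SimpleGraph (2 + m)) {h₁ h₂ : Fin (2 + m)} (h₁≢h₂ : h₁ ≢ h₂) where

  private
    isHub : Fin (2 + m) → Bool
    isHub x = (x == h₁) ∨ (x == h₂)

    h₂′ : Fin (2 + m)
    h₂′ = transpose h₁ zero h₂

    -- sends h₁ to 0 and h₂ to 1, the hubs of K2l m
    π : Permutation′ (2 + m)
    π = Perm.transpose h₁ zero ∘ₚ Perm.transpose h₂′ (suc zero)

    π-h₁ : π ⟨$⟩ʳ h₁ ≡ zero
    π-h₁ rewrite transpose-left h₁ zero = transpose-other h₂′≢0 λ ()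
      where
      h₂′≢0 : zero ≢ h₂′
      h₂′≢0 0≡h₂′ = h₁≢h₂ (Injection.injective (↔⇒↣ (Perm.transpose h₁ zero)) (trans (transpose-left h₁ zero) 0≡h₂′))

    π-h₂ : π ⟨$⟩ʳ h₂ ≡ suc zero
    π-h₂ = transpose-left h₂′ (suc zero)

    π-isHub : ∀ x → (toℕ (π ⟨$⟩ʳ x) ℕ.<ᵇ 2) ≡ isHub x
    π-isHub x = trans (<ᵇ2 (π ⟨$⟩ʳ x))
      (cong₂ _∨_ (trans (cong ((π ⟨$⟩ʳ x) ==_) (sym π-h₁)) (==-injective (Injection.injective (↔⇒↣ π)) x h₁))
                 (trans (cong ((π ⟨$⟩ʳ x) ==_) (sym π-h₂)) (==-injective (Injection.injective (↔⇒↣ π)) x h₂)))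
      where
      <ᵇ2 : (z : Fin (2 + m)) → (toℕ z ℕ.<ᵇ 2) ≡ (z == zero) ∨ (z == suc zero)
      <ᵇ2 zero = refl
      <ᵇ2 (suc zero) = refl
      <ᵇ2 (suc (suc z)) = refl

  Iso-K2l : adj G h₁ h₂ ≡ false →
    (∀ x → x ≢ h₁ → x ≢ h₂ → adj G x h₁ ≡ true × adj G x h₂ ≡ true) →
    (∀ x y → x ≢ y → x ≢ h₁ → x ≢ h₂ → y ≢ h₁ → y ≢ h₂ → adj G x y ≡ false) →
    Iso (adj G) (K2l m)
  Iso-K2l hubs-apart spokes leaves-apart = Iso-permutation π λ x y →
    trans (adj-isHub x y) (sym (cong₂ _xor_ (π-isHub x) (π-isHub y)))
    where
    adj-isHub : ∀ x y → adj G x y ≡ isHub x xor isHub y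
    adj-isHub x y with x ≟ h₁ | x ≟ h₂ | y ≟ h₁ | y ≟ h₂
    ... | yes refl | _ | yes refl | _ = irrefl G x
    ... | yes refl | _ | no _ | yes refl = hubs-apart
    ... | yes refl | _ | no y≢h₁ | no y≢h₂ = trans (SimpleGraph.sym G x y) (proj₁ (spokes y y≢h₁ y≢h₂))
    ... | no _ | yes refl | yes refl | _ = trans (SimpleGraph.sym G x y) hubs-apart
    ... | no _ | yes refl | no _ | yes refl = irrefl G x
    ... | no _ | yes refl | no y≢h₁ | no y≢h₂ = trans (SimpleGraph.sym G x y) (proj₂ (spokes y y≢h₁ y≢h₂))
    ... | no x≢h₁ | no x≢h₂ | yes refl | _ = proj₁ (spokes x x≢h₁ x≢h₂)
    ... | no x≢h₁ | no x≢h₂ | no _ | yes refl = proj₂ (spokes x x≢h₁ x≢h₂)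
    ... | no x≢h₁ | no x≢h₂ | no y≢h₁ | no y≢h₂ with x ≟ y
    ...   | yes refl = irrefl G x
    ...   | no x≢y = leaves-apart x y x≢y x≢h₁ x≢h₂ y≢h₁ y≢h₂

K2l-excluded : ∀ {N} (G : SimpleGraph (suc N)) {h₁ h₂ l₁ l₂ : Fin (suc N)} → Unique (h₁ ∷ h₂ ∷ l₁ ∷ l₂ ∷ []) →
  adj G h₁ h₂ ≡ false →
  (∀ x → x ≢ h₁ → x ≢ h₂ → adj G x h₁ ≡ true × adj G x h₂ ≡ true) →
  (∀ x y → x ≢ y → x ≢ h₁ → x ≢ h₂ → y ≢ h₁ → y ≢ h₂ → adj G x y ≡ false) →
  ¬ (∀ l → 2 ≤ l → ¬ Iso (adj G) (K2l l))
K2l-excluded {zero} G H! _ _ _ _ with Unique⇒length≤ H!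
... | s≤s ()
K2l-excluded {suc m} G H! hubs-apart spokes leaves-apart ¬K2l =
  ¬K2l m (≤-pred (≤-pred (Unique⇒length≤ H!)))
    (Iso-K2l G (Unique-lookup-≢ H! zero (suc zero) 0≢1+n) hubs-apart spokes leaves-apart)

-- Földes–Hammer: a graph that is not split contains an induced 2K₂, C₄ or C₅

𝟙 : Bool → ℕ
𝟙 b = if b then 1 else 0

𝟙-mono : ∀ {b c} → (b ≡ true → c ≡ true) → 𝟙 b ≤ 𝟙 c
𝟙-mono {false} _ = z≤n
𝟙-mono {true} b⇒c rewrite b⇒c refl = ≤-refl

sum-mono-≤ : ∀ {n} {f g : Fin n → ℕ} → (∀ i → f i ≤ g i) → sum f ≤ sum g
sum-mono-≤ {zero} _ = z≤n
sum-mono-≤ {suc n} f≤g = +-mono-≤ (f≤g zero) (sum-mono-≤ (f≤g ∘ suc))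

sum-mono-< : ∀ {n} {f g : Fin n → ℕ} → (∀ i → f i ≤ g i) → ∀ p → f p < g p → sum f < sum g
sum-mono-< f≤g zero fp<gp = +-mono-<-≤ fp<gp (sum-mono-≤ (f≤g ∘ suc))
sum-mono-< f≤g (suc p) fp<gp = +-mono-≤-< (f≤g zero) (sum-mono-< (f≤g ∘ suc) p fp<gp)

count : ∀ {n} → (Fin n → Bool) → ℕ
count p = sum (𝟙 ∘ p)

count-mono-< : ∀ {n} {p q : Fin n → Bool} → (∀ u → p u ≡ true → q u ≡ true) →
  ∀ s → p s ≡ false → q s ≡ true → count p < count q
count-mono-< p⇒q s ps qs = sum-mono-< (λ u → 𝟙-mono (p⇒q u)) s (subst₂ (λ a b → 𝟙 a < 𝟙 b) (sym ps) (sym qs) ≤-refl)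

-- 2K₂ has edges 01 and 23; the cycles are 0-1-2-3-0 and 0-1-2-3-4-0.
2K₂ᵗ : Table 4
2K₂ᵗ = (true ∷ false ∷ false ∷ []) , (false ∷ false ∷ []) , (true ∷ []) , [] , tt

C₄ᵗ : Table 4
C₄ᵗ = (true ∷ false ∷ true ∷ []) , (true ∷ false ∷ []) , (true ∷ []) , [] , tt

C₅ᵗ : Table 5
C₅ᵗ = (true ∷ false ∷ false ∷ true ∷ []) , (true ∷ false ∷ false ∷ []) , (true ∷ false ∷ []) , (true ∷ []) , [] , tt

data Obstruction {n} (A : Graph n) : Set where
  induced-2K₂ : {v : Vec (Fin n) 4} → Unique v → table A v ≡ 2K₂ᵗ → Obstruction A
  induced-C₄ : {v : Vec (Fin n) 4} → Unique v → table A v ≡ C₄ᵗ → Obstruction A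
  induced-C₅ : {v : Vec (Fin n) 5} → Unique v → table A v ≡ C₅ᵗ → Obstruction A

module _ {n} (G : SimpleGraph n) where

  private
    A : Graph n
    A = adj G

  adj-sym : ∀ {u v b} → A u v ≡ b → A v u ≡ b
  adj-sym {u} {v} uv = trans (SimpleGraph.sym G v u) uv

  edge-≢ : ∀ {u v} → A u v ≡ true → u ≢ v
  edge-≢ {u} uv refl = ≡true⇒≢false uv (irrefl G u)

  separated-≢ : ∀ {u v w} → A u w ≡ true → A v w ≡ false → u ≢ v
  separated-≢ uw vw refl = ≡true⇒≢false uw vw

  table₄ : ∀ {a b c d p₁ p₂ p₃ p₄ p₅ p₆} →
    A a b ≡ p₁ → A a c ≡ p₂ → A a d ≡ p₃ → A b c ≡ p₄ → A b d ≡ p₅ → A c d ≡ p₆ →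
    table A (a ∷ b ∷ c ∷ d ∷ []) ≡ ((p₁ ∷ p₂ ∷ p₃ ∷ []) , (p₄ ∷ p₅ ∷ []) , (p₆ ∷ []) , [] , tt)
  table₄ refl refl refl refl refl refl = refl

  2K₂-at : ∀ {a b c d} → A a b ≡ true → A c d ≡ true →
    A a c ≡ false → A a d ≡ false → A b c ≡ false → A b d ≡ false → Obstruction A
  2K₂-at ab cd ac ad bc bd = induced-2K₂ unique (table₄ ab ac ad bc bd cd)
    where
    unique : Unique _
    unique = (edge-≢ ab ∷ separated-≢ ab (adj-sym bc) ∷ separated-≢ ab (adj-sym bd) ∷ [])
           ∷ (separated-≢ (adj-sym ab) (adj-sym ac) ∷ separated-≢ (adj-sym ab) (adj-sym ad) ∷ [])
           ∷ (edge-≢ cd ∷ []) ∷ [] ∷ []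

  C₄-at : ∀ {a b c d} → a ≢ c → b ≢ d → A a b ≡ true → A b c ≡ true → A c d ≡ true → A d a ≡ true →
    A a c ≡ false → A b d ≡ false → Obstruction A
  C₄-at a≢c b≢d ab bc cd da ac bd = induced-C₄ unique (table₄ ab ac (adj-sym da) bc bd cd)
    where
    unique : Unique _
    unique = (edge-≢ ab ∷ a≢c ∷ edge-≢ (adj-sym da) ∷ []) ∷ (edge-≢ bc ∷ b≢d ∷ []) ∷ (edge-≢ cd ∷ []) ∷ [] ∷ []

  C₅-at : ∀ {a b c d e} → A a b ≡ true → A b c ≡ true → A c d ≡ true → A d e ≡ true → A e a ≡ true →
    A a c ≡ false → A a d ≡ false → A b d ≡ false → A b e ≡ false → A c e ≡ false → Obstruction A
  C₅-at ab bc cd de ea ac ad bd be ce = induced-C₅ unique (table-eq ab ac ad (adj-sym ea) bc bd be cd ce de)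
    where
    table-eq : ∀ {a b c d e p₁ p₂ p₃ p₄ p₅ p₆ p₇ p₈ p₉ p₁₀} →
      A a b ≡ p₁ → A a c ≡ p₂ → A a d ≡ p₃ → A a e ≡ p₄ → A b c ≡ p₅ → A b d ≡ p₆ → A b e ≡ p₇ →
      A c d ≡ p₈ → A c e ≡ p₉ → A d e ≡ p₁₀ → table A (a ∷ b ∷ c ∷ d ∷ e ∷ []) ≡
      ((p₁ ∷ p₂ ∷ p₃ ∷ p₄ ∷ []) , (p₅ ∷ p₆ ∷ p₇ ∷ []) , (p₈ ∷ p₉ ∷ []) , (p₁₀ ∷ []) , [] , tt)
    table-eq refl refl refl refl refl refl refl refl refl refl = refl
    unique : Unique _
    unique = (edge-≢ ab ∷ separated-≢ (adj-sym ea) ce ∷ separated-≢ ab (adj-sym bd) ∷ edge-≢ (adj-sym ea) ∷ [])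
           ∷ (edge-≢ bc ∷ separated-≢ (adj-sym ab) (adj-sym ad) ∷ separated-≢ bc (adj-sym ce) ∷ [])
           ∷ (edge-≢ cd ∷ separated-≢ (adj-sym bc) (adj-sym be) ∷ [])
           ∷ (edge-≢ de ∷ []) ∷ [] ∷ []

module FöldesHammer {n} (G : SimpleGraph n) where

  private
    A : Graph n
    A = adj G

  outsideSize : (Fin n → Bool) → ℕ
  outsideSize K = count (not ∘ K)

  outsideEdges : (Fin n → Bool) → ℕ
  outsideEdges K = sum λ u → count λ v → not (K u) ∧ not (K v) ∧ A u v

  Improvement : (Fin n → Bool) → Set
  Improvement K = ∃ λ K′ → IsClique A K′ ×
    (outsideSize K′ < outsideSize K ⊎ (outsideSize K′ ≡ outsideSize K × outsideEdges K′ < outsideEdges K))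

  non-neighbour? : ∀ {P : Fin n → Set} → (∀ k → Dec (P k)) → ∀ x →
    (∃ λ k → P k × A x k ≡ false) ⊎ (∀ k → P k → A x k ≡ true)
  non-neighbour? P? x with any? (λ k → P? k ×-dec (A x k Bool.≟ false))
  ... | yes (k , Pk , xk) = inj₁ (k , Pk , xk)
  ... | no none = inj₂ λ k Pk → ¬-not λ xk → none (k , Pk , xk)

  K-≢ : ∀ {K : Fin n → Bool} {u v} → K u ≡ false → K v ≡ true → u ≢ v
  K-≢ Ku Kv refl = ≡true⇒≢false Kv Ku

  smaller : ∀ {K} → (∃ λ K′ → IsClique A K′ × outsideSize K′ < outsideSize K) → Improvement K
  smaller (K′ , clique′ , lt) = K′ , clique′ , inj₁ lt

  module _ {K : Fin n → Bool} (clique : IsClique A K) where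

    add-vertex : ∀ w → K w ≡ false → (∀ k → K k ≡ true → A w k ≡ true) →
      ∃ λ K′ → IsClique A K′ × outsideSize K′ < outsideSize K
    add-vertex w Kw w~K = K′ , clique′ ,
      count-mono-< (λ u K′u → cong not (∨-conicalˡ _ _ (not-injective K′u))) w
                   (cong not (∨-trueʳ (K w) (==-refl w))) (cong not Kw)
      where
      K′ : Fin n → Bool
      K′ u = K u ∨ (u == w)
      clique′ : IsClique A K′
      clique′ u v u≢v K′u K′v = by-cases (u ≟ w) (v ≟ w)
        where
        by-cases : Dec (u ≡ w) → Dec (v ≡ w) → A u v ≡ true
        by-cases (yes refl) (yes refl) = ⊥-elim (u≢v refl)
        by-cases (yes refl) (no v≢w) = w~K v (∨-resolveˡ K′v (==-≢ v≢w))
        by-cases (no u≢w) (yes refl) = adj-sym G (w~K u (∨-resolveˡ K′u (==-≢ u≢w)))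
        by-cases (no u≢w) (no v≢w) = clique u v u≢v (∨-resolveˡ K′u (==-≢ u≢w)) (∨-resolveˡ K′v (==-≢ v≢w))

  module _ {K : Fin n → Bool} (clique : IsClique A K) where

    module Exchange {x k} (Kx : K x ≡ false) (Kk : K k ≡ true) where

      exchanged : Fin n → Bool
      exchanged = K ∘ transpose x k

      exchanged-member : ∀ {u} → exchanged u ≡ true → u ≡ x ⊎ (u ≢ x × u ≢ k × K u ≡ true)
      exchanged-member {u} Ku′ = by-cases (u ≟ x) (u ≟ k)
        where
        by-cases : Dec (u ≡ x) → Dec (u ≡ k) → u ≡ x ⊎ (u ≢ x × u ≢ k × K u ≡ true)
        by-cases (yes u≡x) _ = inj₁ u≡x
        by-cases (no u≢x) (yes refl) = ⊥-elim (≡true⇒≢false (trans (sym (cong K (transpose-right x u))) Ku′) Kx)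
        by-cases (no u≢x) (no u≢k) = inj₂ (u≢x , u≢k , trans (sym (cong K (transpose-other u≢x u≢k))) Ku′)

      exchanged-clique : (∀ k′ → K k′ ≡ true × k′ ≢ k → A x k′ ≡ true) → IsClique A exchanged
      exchanged-clique x~K∖k u v u≢v Ku′ Kv′ with exchanged-member {u} Ku′ | exchanged-member {v} Kv′
      ... | inj₁ refl | inj₁ refl = ⊥-elim (u≢v refl)
      ... | inj₁ refl | inj₂ (_ , v≢k , Kv) = x~K∖k v (Kv , v≢k)
      ... | inj₂ (_ , u≢k , Ku) | inj₁ refl = adj-sym G (x~K∖k u (Ku , u≢k))
      ... | inj₂ (_ , _ , Ku) | inj₂ (_ , _ , Kv) = clique u v u≢v Ku Kv

      outsideSize-exchanged : outsideSize exchanged ≡ outsideSize K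
      outsideSize-exchanged = sym (sum-permute (𝟙 ∘ not ∘ K) (Perm.transpose x k))

      transpose-fixes : ∀ {c} → c ≢ x → K c ≡ false → transpose k x c ≡ c
      transpose-fixes c≢x Kc = transpose-other (K-≢ {K} Kc Kk) c≢x

      edge-pulled-back : (∀ z → K z ≡ false → z ≢ x → A k z ≡ true → A x z ≡ true) →
        ∀ {a b} → K a ≡ false → K b ≡ false → A (transpose k x a) (transpose k x b) ≡ true → A a b ≡ true
      edge-pulled-back k~⇒x~ {a} {b} Ka Kb ab′ with a ≟ x | b ≟ x
      ... | yes refl | yes refl =
        ⊥-elim (≡true⇒≢false (subst (λ c → A c c ≡ true) (transpose-right k a) ab′) (irrefl G k))
      ... | yes refl | no b≢x =
        k~⇒x~ b Kb b≢x (subst₂ (λ c d → A c d ≡ true) (transpose-right k a) (transpose-fixes b≢x Kb) ab′)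
      ... | no a≢x | yes refl =
        adj-sym G (k~⇒x~ a Ka a≢x
          (adj-sym G (subst₂ (λ c d → A c d ≡ true) (transpose-fixes a≢x Ka) (transpose-right k b) ab′)))
      ... | no a≢x | no b≢x = subst₂ (λ c d → A c d ≡ true) (transpose-fixes a≢x Ka) (transpose-fixes b≢x Kb) ab′

      -- Every outside edge at k is matched by one at x, and the outside edge xy is lost.
      outsideEdges-exchanged : ∀ {y} → K y ≡ false → A x y ≡ true → A y k ≡ false →
        (∀ z → K z ≡ false → z ≢ x → A k z ≡ true → A x z ≡ true) → outsideEdges exchanged < outsideEdges K
      outsideEdges-exchanged {y} Ky xy yk k~⇒x~ = begin-strict
          outsideEdges exchanged
        ≡⟨ sum-cong-≗ (λ u → sum-cong-≗ (λ v → cong (λ t → 𝟙 (not (exchanged u) ∧ not (exchanged v) ∧ t))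
             (sym (cong₂ A (inverseˡ π) (inverseˡ π))))) ⟩
          sum (λ u → sum (λ v → h (σ u) (σ v)))
        ≡⟨ sum-cong-≗ (λ u → sym (sum-permute (h (σ u)) π)) ⟩
          sum (λ u → sum (h (σ u)))
        ≡⟨ sym (sum-permute (λ a → sum (h a)) π) ⟩
          sum (λ a → sum (h a))
        <⟨ sum-mono-< (λ a → sum-mono-≤ (h≤ a)) x (sum-mono-< (h≤ x) y hxy<) ⟩
          outsideEdges K
        ∎
        where
        open ≤-Reasoning
        π : Permutation′ n
        π = Perm.transpose x k
        σ τ : Fin n → Fin n
        σ = π ⟨$⟩ʳ_
        τ = π ⟨$⟩ˡ_
        h : Fin n → Fin n → ℕ
        h a b = 𝟙 (not (K a) ∧ not (K b) ∧ A (τ a) (τ b))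
        h≤ : ∀ a b → h a b ≤ 𝟙 (not (K a) ∧ not (K b) ∧ A a b)
        h≤ a b = 𝟙-mono λ e → let (Ka , Kb , ab′) = ∧₃-true e in
          subst₂ (λ c d → (c ∧ d ∧ A a b) ≡ true) (sym Ka) (sym Kb) (edge-pulled-back k~⇒x~ (not-injective Ka) (not-injective Kb) ab′)
        hxy< : h x y < 𝟙 (not (K x) ∧ not (K y) ∧ A x y)
        hxy< rewrite transpose-right k x | transpose-fixes (edge-≢ G xy ∘ sym) Ky | Kx | Ky | xy | adj-sym G yk = s≤s z≤n

      add-both : (∀ k′ → K k′ ≡ true × k′ ≢ k → A x k′ ≡ true) →
        ∀ {y} → K y ≡ false → A x y ≡ true → (∀ k′ → K k′ ≡ true × k′ ≢ k → A y k′ ≡ true) → Improvement K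
      add-both x~K∖k {y} Ky xy y~K∖k =
        let K″ , clique″ , lt = add-vertex (exchanged-clique x~K∖k) y (trans (cong K y-fixed) Ky) y~exchanged
        in K″ , clique″ , inj₁ (subst (outsideSize K″ <_) outsideSize-exchanged lt)
        where
        y-fixed : transpose x k y ≡ y
        y-fixed = transpose-other (edge-≢ G xy ∘ sym) (K-≢ {K} Ky Kk)
        y~exchanged : ∀ k′ → exchanged k′ ≡ true → A y k′ ≡ true
        y~exchanged k′ Kk′ with exchanged-member {k′} Kk′
        ... | inj₁ refl = adj-sym G xy
        ... | inj₂ (_ , k′≢k , Kk′) = y~K∖k k′ (Kk′ , k′≢k)

    in-K∖? : ∀ k₀ k → Dec (K k ≡ true × k ≢ k₀)
    in-K∖? k₀ k = (K k Bool.≟ true) ×-dec ¬? (k ≟ k₀)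

    module _ {x y} (Kx : K x ≡ false) (Ky : K y ≡ false) (xy : A x y ≡ true) where

      -- Either y also sees K - k, and K - k + x + y is a larger clique, or y, z and K give a C₄ or C₅.
      exchange-blocked : ∀ {k z} → K k ≡ true → A x k ≡ false → A y k ≡ false →
        (∀ k′ → K k′ ≡ true × k′ ≢ k → A x k′ ≡ true) →
        K z ≡ false → z ≢ x → A k z ≡ true → A x z ≡ false → A y z ≡ true → Obstruction A ⊎ Improvement K
      exchange-blocked {k} {z} Kk xk yk x~K∖k Kz z≢x kz xz yz with non-neighbour? (in-K∖? k) y
      ... | inj₂ y~K∖k = inj₂ (Exchange.add-both Kx Kk x~K∖k Ky xy y~K∖k)
      ... | inj₁ (k″ , (Kk″ , k″≢k) , yk″) with A z k″ in zk″
      ...   | true = inj₁ (C₄-at G (z≢x ∘ sym) (K-≢ Ky Kk″) xy yz zk″ (adj-sym G (x~K∖k k″ (Kk″ , k″≢k))) xz yk″)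
      ...   | false = inj₁ (C₅-at G xy yz (adj-sym G kz) (clique k k″ (k″≢k ∘ sym) Kk Kk″)
                              (adj-sym G (x~K∖k k″ (Kk″ , k″≢k))) xz xk yk yk″ zk″)

      exchange : ∀ {k} → K k ≡ true → A x k ≡ false → A y k ≡ false →
        (∀ k′ → K k′ ≡ true × k′ ≢ k → A x k′ ≡ true) → Obstruction A ⊎ Improvement K
      exchange {k} Kk xk yk x~K∖k
        with any? (λ z → (K z Bool.≟ false) ×-dec ¬? (z ≟ x) ×-dec (A k z Bool.≟ true) ×-dec (A x z Bool.≟ false))
      ... | no none = inj₂ (exchanged , exchanged-clique x~K∖k , inj₂ (outsideSize-exchanged ,
              outsideEdges-exchanged Ky xy yk λ z Kz z≢x kz → ¬-not λ xz → none (z , Kz , z≢x , kz , xz)))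
        where open Exchange Kx Kk
      ... | yes (z , Kz , z≢x , kz , xz) with A y z in yz
      ...   | true = exchange-blocked Kk xk yk x~K∖k Kz z≢x kz xz yz
      ...   | false = inj₁ (2K₂-at G xy (adj-sym G kz) xz xk yz yk)


    common-non-neighbour : ∀ {x y k} → K x ≡ false → K y ≡ false → A x y ≡ true →
      K k ≡ true → A x k ≡ false → A y k ≡ false → Obstruction A ⊎ Improvement K
    common-non-neighbour {x} {y} {k} Kx Ky xy Kk xk yk
      with non-neighbour? (in-K∖? k) x | non-neighbour? (in-K∖? k) y
    ... | inj₂ x~K∖k | _ = exchange Kx Ky xy Kk xk yk x~K∖k
    ... | inj₁ _ | inj₂ y~K∖k = exchange Ky Kx (adj-sym G xy) Kk yk xk y~K∖k
    ... | inj₁ (k′ , (Kk′ , k′≢k) , xk′) | inj₁ (k″ , (Kk″ , k″≢k) , yk″) with A x k″ in xk″ | A y k′ in yk′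
    ...   | false | _ = inj₁ (2K₂-at G xy (clique k k″ (k″≢k ∘ sym) Kk Kk″) xk xk″ yk yk″)
    ...   | true | false = inj₁ (2K₂-at G xy (clique k k′ (k′≢k ∘ sym) Kk Kk′) xk xk′ yk yk′)
    ...   | true | true = inj₁ (C₄-at G (K-≢ Kx Kk′) (K-≢ Ky Kk″) xy yk′
                                (clique k′ k″ (separated-≢ G (adj-sym G xk″) (adj-sym G xk′) ∘ sym) Kk′ Kk″)
                                (adj-sym G xk″) xk′ yk″)

    improve-at-edge : ∀ {x y} → K x ≡ false → K y ≡ false → A x y ≡ true → Obstruction A ⊎ Improvement K
    improve-at-edge {x} {y} Kx Ky xy
      with non-neighbour? (λ k → K k Bool.≟ true) x | non-neighbour? (λ k → K k Bool.≟ true) y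
    ... | inj₂ x~K | _ = inj₂ (smaller (add-vertex clique x Kx x~K))
    ... | inj₁ _ | inj₂ y~K = inj₂ (smaller (add-vertex clique y Ky y~K))
    ... | inj₁ (k₁ , Kk₁ , xk₁) | inj₁ (k₂ , Kk₂ , yk₂) with A x k₂ in xk₂ | A y k₁ in yk₁
    ...   | false | _ = common-non-neighbour Kx Ky xy Kk₂ xk₂ yk₂
    ...   | true | false = common-non-neighbour Kx Ky xy Kk₁ xk₁ yk₁
    ...   | true | true = inj₁ (C₄-at G (K-≢ Kx Kk₁) (K-≢ Ky Kk₂) xy yk₁
                                (clique k₁ k₂ (separated-≢ G (adj-sym G xk₂) (adj-sym G xk₁) ∘ sym) Kk₁ Kk₂)
                                (adj-sym G xk₂) xk₁ yk₂)

  improve : ∀ {K} → IsClique A K → IsSplit A ⊎ Obstruction A ⊎ Improvement K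
  improve {K} clique
    with any? (λ x → any? (λ y → (K x Bool.≟ false) ×-dec (K y Bool.≟ false) ×-dec (A x y Bool.≟ true)))
  ... | no none = inj₁ (K , clique , λ u v _ Ku Kv → ¬-not λ uv → none (u , v , Ku , Kv , uv))
  ... | yes (x , y , Kx , Ky , xy) = inj₂ (improve-at-edge clique Kx Ky xy)

  -- lexicographic recursion on (outsideSize K, outsideEdges K), bounded by o and e
  split-or-obstruction-from : ∀ o e {K} → IsClique A K → outsideSize K ≤ o → outsideEdges K ≤ e → IsSplit A ⊎ Obstruction A
  continue : ∀ o e {K} → IsSplit A ⊎ Obstruction A ⊎ Improvement K → outsideSize K ≤ o → outsideEdges K ≤ e →
    IsSplit A ⊎ Obstruction A

  split-or-obstruction-from o e clique = continue o e (improve clique)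

  continue _ _ (inj₁ split) _ _ = inj₁ split
  continue _ _ (inj₂ (inj₁ obstruction)) _ _ = inj₂ obstruction
  continue zero _ (inj₂ (inj₂ (_ , _ , inj₁ K′<K))) K≤0 _ = ⊥-elim (n≮0 (≤-trans K′<K K≤0))
  continue (suc o) _ (inj₂ (inj₂ (K′ , clique′ , inj₁ K′<K))) K≤o _ =
    split-or-obstruction-from o (outsideEdges K′) clique′ (≤-pred (≤-trans K′<K K≤o)) ≤-refl
  continue _ zero (inj₂ (inj₂ (_ , _ , inj₂ (_ , K′<K)))) _ K≤0 = ⊥-elim (n≮0 (≤-trans K′<K K≤0))
  continue o (suc e) (inj₂ (inj₂ (K′ , clique′ , inj₂ (K′≡K , K′<K)))) K≤o K≤e =
    split-or-obstruction-from o e clique′ (subst (_≤ o) (sym K′≡K) K≤o) (≤-pred (≤-trans K′<K K≤e))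

  split-or-obstruction : IsSplit A ⊎ Obstruction A
  split-or-obstruction = split-or-obstruction-from _ _ {λ _ → false} (λ _ _ _ ()) ≤-refl ≤-refl

-- Eliminating the obstructions

escape-edge : ∀ {n} {A : Graph n} (X : Fin n → Bool) {u w} → Reach A u w → X u ≡ true → X w ≡ false →
  ∃₂ λ x y → X x ≡ true × X y ≡ false × A x y ≡ true
escape-edge X here Xu Xw = ⊥-elim (≡true⇒≢false Xu Xw)
escape-edge X {u} (step {v = v} uv v⇝w) Xu Xw with X v in Xv
... | true = escape-edge X v⇝w Xv Xw
... | false = u , v , Xu , Xv , uv

or : ∀ {k} → Vec Bool k → Bool
or [] = false
or (b ∷ bs) = b ∨ or bs

or-map-∈ᵇ : ∀ {n k} (f : Fin n → Bool) {x} (xs : Vec (Fin n) k) → x ∈ᵇ xs ≡ true → f x ≡ true → or (map f xs) ≡ true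
or-map-∈ᵇ f {x} (y ∷ ys) x∈ fx with x ≟ y
... | yes refl rewrite fx = refl
... | no _ = ∨-trueʳ (f y) (or-map-∈ᵇ f ys x∈ fx)

table-adj : ∀ {n k} (G : SimpleGraph n) {W : Vec (Fin n) k} {t} → table (adj G) W ≡ t →
  ∀ i j → adj G (lookup W i) (lookup W j) ≡ ⟦ t ⟧ i j
table-adj G {W} refl i j = sym (⟦table⟧ G W i j)

module Elimination {N} (G : SimpleGraph (suc N)) (connected : Connected (adj G)) (split : AllContractionsSplit (adj G)) where

  private
    V : Set
    V = Fin (suc N)
    A : Graph (suc N)
    A = adj G

  no-bad-induced : ∀ {k} {W : Vec V (suc k)} → Unique W → ∀ {t} → table A W ≡ t →
    hasNonSplitContractionᵇ ⟦ t ⟧ ≡ true → ⊥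
  no-bad-induced W! eq bad = hasNonSplitContractionᵇ-sound _ bad (AllContractionsSplit-↪ (table-↪ G W! eq) split)

  -- A row towards H that is not good would give an induced subgraph with a non-split contraction.
  attach-row : ∀ {k} {H : Vec V k} → Unique H → ∀ {t} → table A H ≡ t → ∀ {y} → y ∈ᵇ H ≡ false →
    (good : Vec Bool k → Bool) → allVec k (λ r → good r ∨ hasNonSplitContractionᵇ ⟦ r , t ⟧) ≡ true →
    good (map (A y) H) ≡ true
  attach-row {k} {H} H! eq {y} y∉ good checked with good (map (A y) H) in g
  ... | true = refl
  ... | false = ⊥-elim (no-bad-induced (Unique-∷ y∉ H!) (cong (map (A y) H ,_) eq)
                  (∨-resolveʳ (allVec-sound k _ checked (map (A y) H)) g))

  attach-pair : ∀ {k} {H : Vec V k} → Unique H → ∀ {t} → table A H ≡ t →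
    ∀ {y z} → y ∈ᵇ H ≡ false → z ∈ᵇ (y ∷ H) ≡ false →
    (good : Vec Bool (suc k) → Vec Bool k → Bool) →
    allVec k (λ ry → allVec (suc k) (λ rz → good rz ry ∨ hasNonSplitContractionᵇ ⟦ rz , ry , t ⟧)) ≡ true →
    good (map (A z) (y ∷ H)) (map (A y) H) ≡ true
  attach-pair {k} {H} H! eq {y} y∉ z∉ good checked =
    attach-row (Unique-∷ y∉ H!) (cong (map (A y) H ,_) eq) z∉ (λ rz → good rz (map (A y) H))
      (allVec-sound k _ checked (map (A y) H))

  module 2K₂-Case {a b c d : V} (H! : Unique (a ∷ b ∷ c ∷ d ∷ [])) (H-2K₂ : table A (a ∷ b ∷ c ∷ d ∷ []) ≡ 2K₂ᵗ)
                  (¬P5 : ¬ Iso A P5) (¬Hammer : ¬ Iso A Hammer) (¬Butterfly : ¬ Iso A Butterfly) where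

    H : Vec V 4
    H = a ∷ b ∷ c ∷ d ∷ []

    H-≢ : ∀ i j → i ≢ j → lookup H i ≢ lookup H j
    H-≢ = Unique-lookup-≢ H!

    2K₂-adj : ∀ i j → A (lookup H i) (lookup H j) ≡ ⟦ 2K₂ᵗ ⟧ i j
    2K₂-adj = table-adj G H-2K₂

    ∉H : ∀ {x} → x ≢ a → x ≢ b → x ≢ c → x ≢ d → x ∈ᵇ H ≡ false
    ∉H x≢a x≢b x≢c x≢d rewrite ==-≢ x≢a | ==-≢ x≢b | ==-≢ x≢c | ==-≢ x≢d = refl

    two-sidedᵇ : Vec Bool 4 → Bool
    two-sidedᵇ (p ∷ q ∷ r ∷ s ∷ []) = (p ∨ q) ∧ (r ∨ s)

    outsiders-independent : ∀ {p q} → p ∈ᵇ H ≡ false → q ∈ᵇ H ≡ false → A p q ≡ false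
    outsiders-independent {p} {q} p∉ q∉ with p ≟ q
    ... | yes refl = irrefl G p
    ... | no p≢q = not-injective (attach-pair H! H-2K₂ q∉ (∉ᵇ-∷⁺ {ys = H} p≢q p∉) (λ rp _ → not (head rp)) refl)

    -- A two-sided outside vertex y leaves no room for a sixth vertex, and G is one of the excluded graphs on five.
    spans : ∀ {y} → y ∈ᵇ H ≡ false → two-sidedᵇ (map (A y) H) ≡ true → ∀ z → z ∈ᵇ (y ∷ H) ≡ true
    spans {y} y∉ ys z with z ∈ᵇ (y ∷ H) in z∈?
    ... | true = refl
    ... | false with escape-edge (_∈ᵇ (y ∷ H)) (connected y z) (∈ᵇ-lookup (y ∷ H) zero) z∈?
    ...   | x , w , x∈ , w∉ , xw =
      ⊥-elim (≡true⇒≢false (or-map-∈ᵇ (A w) (y ∷ H) x∈ (adj-sym G xw)) (not-injective w-detached))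
      where
      w-detached : not (or (map (A w) (y ∷ H))) ≡ true
      w-detached = ∨-resolveʳ (attach-pair H! H-2K₂ {z = w} y∉ w∉ (λ rw ry → not (two-sidedᵇ ry) ∨ not (or rw)) refl)
                                (cong not ys)

    excluded-on-five : ∀ r → two-sidedᵇ r ≡ true → ¬ Iso A ⟦ r , 2K₂ᵗ ⟧
    excluded-on-five (true ∷ true ∷ true ∷ true ∷ []) _ = ¬Iso-by (tabulate id) (tabulate id) refl ¬Butterfly
    excluded-on-five (true ∷ true ∷ true ∷ false ∷ []) _ =
      ¬Iso-by (# 2 ∷ # 3 ∷ # 4 ∷ # 1 ∷ # 0 ∷ []) (# 4 ∷ # 3 ∷ # 0 ∷ # 1 ∷ # 2 ∷ []) refl ¬Hammer
    excluded-on-five (true ∷ true ∷ false ∷ true ∷ []) _ =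
      ¬Iso-by (# 2 ∷ # 3 ∷ # 4 ∷ # 0 ∷ # 1 ∷ []) (# 3 ∷ # 4 ∷ # 0 ∷ # 1 ∷ # 2 ∷ []) refl ¬Hammer
    excluded-on-five (true ∷ false ∷ true ∷ true ∷ []) _ =
      ¬Iso-by (# 2 ∷ # 1 ∷ # 0 ∷ # 3 ∷ # 4 ∷ []) (# 2 ∷ # 1 ∷ # 0 ∷ # 3 ∷ # 4 ∷ []) refl ¬Hammer
    excluded-on-five (false ∷ true ∷ true ∷ true ∷ []) _ =
      ¬Iso-by (# 2 ∷ # 0 ∷ # 1 ∷ # 3 ∷ # 4 ∷ []) (# 1 ∷ # 2 ∷ # 0 ∷ # 3 ∷ # 4 ∷ []) refl ¬Hammer
    excluded-on-five (true ∷ false ∷ true ∷ false ∷ []) _ =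
      ¬Iso-by (# 2 ∷ # 1 ∷ # 0 ∷ # 3 ∷ # 4 ∷ []) (# 2 ∷ # 1 ∷ # 0 ∷ # 3 ∷ # 4 ∷ []) refl ¬P5
    excluded-on-five (true ∷ false ∷ false ∷ true ∷ []) _ =
      ¬Iso-by (# 2 ∷ # 1 ∷ # 0 ∷ # 4 ∷ # 3 ∷ []) (# 2 ∷ # 1 ∷ # 0 ∷ # 4 ∷ # 3 ∷ []) refl ¬P5
    excluded-on-five (false ∷ true ∷ true ∷ false ∷ []) _ =
      ¬Iso-by (# 2 ∷ # 0 ∷ # 1 ∷ # 3 ∷ # 4 ∷ []) (# 1 ∷ # 2 ∷ # 0 ∷ # 3 ∷ # 4 ∷ []) refl ¬P5
    excluded-on-five (false ∷ true ∷ false ∷ true ∷ []) _ =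
      ¬Iso-by (# 2 ∷ # 0 ∷ # 1 ∷ # 4 ∷ # 3 ∷ []) (# 1 ∷ # 2 ∷ # 0 ∷ # 4 ∷ # 3 ∷ []) refl ¬P5
    excluded-on-five (true ∷ true ∷ false ∷ false ∷ []) ()
    excluded-on-five (true ∷ false ∷ false ∷ false ∷ []) ()
    excluded-on-five (false ∷ true ∷ false ∷ false ∷ []) ()
    excluded-on-five (false ∷ false ∷ _ ∷ _ ∷ []) ()

    no-two-sided : ∀ {y} → y ∈ᵇ H ≡ false → two-sidedᵇ (map (A y) H) ≡ true → ⊥
    no-two-sided {y} y∉ ys =
      excluded-on-five (map (A y) H) ys (Iso-table G (Unique-∷ y∉ H!) (spans y∉ ys) (cong (map (A y) H ,_) H-2K₂))

    -- Leave the edge ab along a path towards c: the first step away from {a, b} and their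
    -- neighbours starts at an outside vertex that also sees c or d.
    near-ab : V → Bool
    near-ab w = (w == a) ∨ (w == b) ∨ A w a ∨ A w b

    far-c : near-ab c ≡ false
    far-c rewrite ==-≢ (H-≢ (# 2) (# 0) (λ ())) | ==-≢ (H-≢ (# 2) (# 1) (λ ()))
                | 2K₂-adj (# 2) (# 0) | 2K₂-adj (# 2) (# 1) = refl

    impossible : ⊥
    impossible with escape-edge near-ab (connected a c) (∨-trueˡ _ (==-refl a)) far-c
    ... | x , w , near-x , far-w , xw with ∨₄-false {w == a} {w == b} {A w a} {A w b} far-w
    ...   | w≠a , w≠b , wa , wb = leave (x ≟ a) (x ≟ b)
      where
      leave : Dec (x ≡ a) → Dec (x ≡ b) → ⊥
      leave (yes refl) _ = ≡true⇒≢false (adj-sym G xw) wa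
      leave (no _) (yes refl) = ≡true⇒≢false (adj-sym G xw) wb
      leave (no x≢a) (no x≢b) = arrive (w ≟ c) (w ≟ d)
        where
        x~ab : (A x a ∨ A x b) ≡ true
        x~ab = ∨-resolveʳ (∨-resolveʳ near-x (==-≢ x≢a)) (==-≢ x≢b)
        x≢c : x ≢ c
        x≢c refl = ≡true⇒≢false x~ab (cong₂ _∨_ (2K₂-adj (# 2) (# 0)) (2K₂-adj (# 2) (# 1)))
        x≢d : x ≢ d
        x≢d refl = ≡true⇒≢false x~ab (cong₂ _∨_ (2K₂-adj (# 3) (# 0)) (2K₂-adj (# 3) (# 1)))
        x∉ : x ∈ᵇ H ≡ false
        x∉ = ∉H x≢a x≢b x≢c x≢d
        arrive : Dec (w ≡ c) → Dec (w ≡ d) → ⊥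
        arrive (yes refl) _ = no-two-sided x∉ (cong₂ _∧_ x~ab (∨-trueˡ _ xw))
        arrive (no _) (yes refl) = no-two-sided x∉ (cong₂ _∧_ x~ab (∨-trueʳ _ xw))
        arrive (no w≢c) (no w≢d) = ≡true⇒≢false xw (outsiders-independent x∉ (∉H (==⇒≢ w≠a) (==⇒≢ w≠b) w≢c w≢d))

  row-entry : ∀ {k} {x : V} {H : Vec V k} {r} → map (A x) H ≡ r → ∀ i → A x (lookup H i) ≡ lookup r i
  row-entry {x = x} {H} eq i = trans (sym (lookup-map i (A x) H)) (cong (λ r → lookup r i) eq)

  C₄-rowᵇ : Vec Bool 4 → Bool
  C₄-rowᵇ (false ∷ false ∷ false ∷ false ∷ []) = true
  C₄-rowᵇ (true ∷ false ∷ true ∷ false ∷ []) = true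
  C₄-rowᵇ (false ∷ true ∷ false ∷ true ∷ []) = true
  C₄-rowᵇ (true ∷ true ∷ true ∷ true ∷ []) = true
  C₄-rowᵇ _ = false

  -- If y sees H then z does not see y, and either z does not see H or sees it exactly as y does.
  C₄-pairᵇ : Vec Bool 5 → Vec Bool 4 → Bool
  C₄-pairᵇ (zy ∷ rz) ry = not (or ry) ∨ (not zy ∧ (not (or rz) ∨ does (≡-dec Bool._≟_ rz ry)))

  module C₄-Case {a₁ b₁ a₂ b₂ : V} (H! : Unique (a₁ ∷ b₁ ∷ a₂ ∷ b₂ ∷ []))
                 (H-C₄ : table A (a₁ ∷ b₁ ∷ a₂ ∷ b₂ ∷ []) ≡ C₄ᵗ) where

    H : Vec V 4
    H = a₁ ∷ b₁ ∷ a₂ ∷ b₂ ∷ []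

    H-≢ : ∀ i j → i ≢ j → lookup H i ≢ lookup H j
    H-≢ = Unique-lookup-≢ H!

    C₄-adj : ∀ i j → A (lookup H i) (lookup H j) ≡ ⟦ C₄ᵗ ⟧ i j
    C₄-adj = table-adj G H-C₄

    row-type : ∀ {y} → y ∈ᵇ H ≡ false → C₄-rowᵇ (map (A y) H) ≡ true
    row-type y∉ = attach-row H! H-C₄ y∉ C₄-rowᵇ refl

    pair : ∀ {p q} → p ∈ᵇ H ≡ false → q ∈ᵇ H ≡ false → p ≢ q → or (map (A q) H) ≡ true →
      A p q ≡ false × (or (map (A p) H) ≡ false ⊎ map (A p) H ≡ map (A q) H)
    pair {p} {q} p∉ q∉ p≢q q-attached
      with ∧-true (∨-resolveʳ (attach-pair H! H-C₄ {z = p} q∉ (∉ᵇ-∷⁺ {ys = H} p≢q p∉) C₄-pairᵇ refl) (cong not q-attached))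
    ... | pq , rows with or (map (A p) H) in p-attached
    ...   | false = not-injective pq , inj₁ refl
    ...   | true = not-injective pq , inj₂ (does⇒ (≡-dec Bool._≟_ _ _) (∨-resolveʳ rows (cong not p-attached)))

    attached : ∀ {w} → w ∈ᵇ H ≡ false → or (map (A w) H) ≡ true
    attached {w} w∉ with or (map (A w) H) in w-attached
    ... | true = refl
    ... | false with escape-edge X (connected a₁ w) (∨-trueˡ _ (∈ᵇ-lookup H zero)) (cong₂ _∨_ w∉ w-attached)
      where
      X : V → Bool
      X v = (v ∈ᵇ H) ∨ or (map (A v) H)
    ...   | x , v , Xx , Xv , xv with ∨-conicalˡ (v ∈ᵇ H) _ Xv | ∨-conicalʳ (v ∈ᵇ H) _ Xv | x ∈ᵇ H in x∈?
    ...     | v∉ | v-detached | true = ⊥-elim (≡true⇒≢false (or-map-∈ᵇ (A v) H x∈? (adj-sym G xv)) v-detached)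
    ...     | v∉ | v-detached | false = ⊥-elim (≡true⇒≢false xv (adj-sym G (proj₁ (pair v∉ x∈? (edge-≢ G xv ∘ sym) Xx))))

    independent : ∀ {p q} → p ∈ᵇ H ≡ false → q ∈ᵇ H ≡ false → A p q ≡ false
    independent {p} {q} p∉ q∉ with p ≟ q
    ... | yes refl = irrefl G p
    ... | no p≢q = proj₁ (pair p∉ q∉ p≢q (attached q∉))

    same-row : ∀ {p q} → p ∈ᵇ H ≡ false → q ∈ᵇ H ≡ false → map (A p) H ≡ map (A q) H
    same-row {p} {q} p∉ q∉ with p ≟ q
    ... | yes refl = refl
    ... | no p≢q with proj₂ (pair p∉ q∉ p≢q (attached q∉))
    ...   | inj₁ p-detached = ⊥-elim (≡true⇒≢false (attached p∉) p-detached)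
    ...   | inj₂ rows = rows

    outsider-row : ∀ {x y r} → x ∈ᵇ H ≡ false → y ∈ᵇ H ≡ false → map (A y) H ≡ r →
      ∀ i → A x (lookup H i) ≡ lookup r i
    outsider-row x∉ y∉ r-y = row-entry (trans (same-row x∉ y∉) r-y)

    -- The outside vertices all see exactly a₁ and a₂, so G is K_{2,l} with hubs a₁, a₂.
    hubs-a : ∀ {y₀} → y₀ ∈ᵇ H ≡ false → map (A y₀) H ≡ (true ∷ false ∷ true ∷ false ∷ []) →
      ¬ (∀ l → 2 ≤ l → ¬ Iso A (K2l l))
    hubs-a {y₀} y₀∉ r₀ = K2l-excluded G unique (C₄-adj (# 0) (# 2)) spokes leaves-apart
      where
      unique : Unique (a₁ ∷ a₂ ∷ b₁ ∷ b₂ ∷ [])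
      unique = (H-≢ (# 0) (# 2) (λ ()) ∷ H-≢ (# 0) (# 1) (λ ()) ∷ H-≢ (# 0) (# 3) (λ ()) ∷ [])
             ∷ (H-≢ (# 2) (# 1) (λ ()) ∷ H-≢ (# 2) (# 3) (λ ()) ∷ []) ∷ (H-≢ (# 1) (# 3) (λ ()) ∷ []) ∷ [] ∷ []
      leaf : ∀ x → x ≢ a₁ → x ≢ a₂ → x ≡ b₁ ⊎ x ≡ b₂ ⊎ x ∈ᵇ H ≡ false
      leaf x x≢a₁ x≢a₂ with x ∈ᵇ H in x∈?
      ... | false = inj₂ (inj₂ refl)
      ... | true with ∈ᵇ⇒lookup {x = x} H x∈?
      ...   | zero , refl = ⊥-elim (x≢a₁ refl)
      ...   | suc zero , refl = inj₁ refl
      ...   | suc (suc zero) , refl = ⊥-elim (x≢a₂ refl)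
      ...   | suc (suc (suc zero)) , refl = inj₂ (inj₁ refl)
      spokes : ∀ x → x ≢ a₁ → x ≢ a₂ → A x a₁ ≡ true × A x a₂ ≡ true
      spokes x x≢a₁ x≢a₂ with leaf x x≢a₁ x≢a₂
      ... | inj₁ refl = C₄-adj (# 1) (# 0) , C₄-adj (# 1) (# 2)
      ... | inj₂ (inj₁ refl) = C₄-adj (# 3) (# 0) , C₄-adj (# 3) (# 2)
      ... | inj₂ (inj₂ x∉) = outsider-row x∉ y₀∉ r₀ (# 0) , outsider-row x∉ y₀∉ r₀ (# 2)
      leaves-apart : ∀ x y → x ≢ y → x ≢ a₁ → x ≢ a₂ → y ≢ a₁ → y ≢ a₂ → A x y ≡ false
      leaves-apart x y x≢y x≢a₁ x≢a₂ y≢a₁ y≢a₂ with leaf x x≢a₁ x≢a₂ | leaf y y≢a₁ y≢a₂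
      ... | inj₁ refl | inj₁ refl = ⊥-elim (x≢y refl)
      ... | inj₁ refl | inj₂ (inj₁ refl) = C₄-adj (# 1) (# 3)
      ... | inj₁ refl | inj₂ (inj₂ y∉) = adj-sym G (outsider-row y∉ y₀∉ r₀ (# 1))
      ... | inj₂ (inj₁ refl) | inj₁ refl = C₄-adj (# 3) (# 1)
      ... | inj₂ (inj₁ refl) | inj₂ (inj₁ refl) = ⊥-elim (x≢y refl)
      ... | inj₂ (inj₁ refl) | inj₂ (inj₂ y∉) = adj-sym G (outsider-row y∉ y₀∉ r₀ (# 3))
      ... | inj₂ (inj₂ x∉) | inj₁ refl = outsider-row x∉ y₀∉ r₀ (# 1)
      ... | inj₂ (inj₂ x∉) | inj₂ (inj₁ refl) = outsider-row x∉ y₀∉ r₀ (# 3)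
      ... | inj₂ (inj₂ x∉) | inj₂ (inj₂ y∉) = independent x∉ y∉

    -- The outside vertices all see the whole cycle: one gives W₄, two give E₂ ∨ C₄, and three contain
    -- a seven-vertex induced subgraph with a non-split contraction.
    wheel : ∀ {y₀} → y₀ ∈ᵇ H ≡ false → map (A y₀) H ≡ (true ∷ true ∷ true ∷ true ∷ []) →
      ¬ Iso A W4 → ¬ Iso A E2∨C4 → ⊥
    wheel {y₀} y₀∉ r₀ ¬W4 ¬E2∨C4 with any? (λ y → y ∈ᵇ (y₀ ∷ H) Bool.≟ false)
    ... | no only-y₀ = ¬Iso-by (tabulate id) (tabulate id) refl ¬W4
                         (Iso-table G (Unique-∷ y₀∉ H!) (covering {W = y₀ ∷ H} only-y₀) (cong₂ _,_ r₀ H-C₄))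
    ... | yes (y₁ , y₁∉′) with ∉ᵇ-∷⁻ {x = y₁} {y₀} {H} y₁∉′ | any? (λ y → y ∈ᵇ (y₁ ∷ y₀ ∷ H) Bool.≟ false)
    ...   | _ , y₁∉ | no only-y₀y₁ =
      ¬Iso-by (tabulate id) (tabulate id) refl ¬E2∨C4
        (Iso-table G (Unique-∷ y₁∉′ (Unique-∷ y₀∉ H!)) (covering {W = y₁ ∷ y₀ ∷ H} only-y₀y₁) table₁)
      where
      table₁ : table A (y₁ ∷ y₀ ∷ H) ≡
        ((false ∷ true ∷ true ∷ true ∷ true ∷ []) , (true ∷ true ∷ true ∷ true ∷ []) , C₄ᵗ)
      table₁ = cong₂ _,_ (cong₂ _∷_ (independent y₁∉ y₀∉) (trans (same-row y₁∉ y₀∉) r₀)) (cong₂ _,_ r₀ H-C₄)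
    ...   | _ , y₁∉ | yes (y₂ , y₂∉′) with ∉ᵇ-∷⁻ {x = y₂} {y₁} {y₀ ∷ H} y₂∉′
    ...     | _ , y₂∉″ with ∉ᵇ-∷⁻ {x = y₂} {y₀} {H} y₂∉″
    ...       | _ , y₂∉ = no-bad-induced (Unique-∷ y₂∉′ (Unique-∷ y₁∉′ (Unique-∷ y₀∉ H!))) table₂ refl
      where
      table₂ : table A (y₂ ∷ y₁ ∷ y₀ ∷ H) ≡
        ((false ∷ false ∷ true ∷ true ∷ true ∷ true ∷ []) , (false ∷ true ∷ true ∷ true ∷ true ∷ []) ,
         (true ∷ true ∷ true ∷ true ∷ []) , C₄ᵗ)
      table₂ = cong₂ _,_
                 (cong₂ _∷_ (independent y₂∉ y₁∉) (cong₂ _∷_ (independent y₂∉ y₀∉) (trans (same-row y₂∉ y₀∉) r₀)))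
                 (cong₂ _,_ (cong₂ _∷_ (independent y₁∉ y₀∉) (trans (same-row y₁∉ y₀∉) r₀)) (cong₂ _,_ r₀ H-C₄))

    rotated-unique : Unique (b₁ ∷ a₂ ∷ b₂ ∷ a₁ ∷ [])
    rotated-unique = (H-≢ (# 1) (# 2) (λ ()) ∷ H-≢ (# 1) (# 3) (λ ()) ∷ H-≢ (# 1) (# 0) (λ ()) ∷ [])
                   ∷ (H-≢ (# 2) (# 3) (λ ()) ∷ H-≢ (# 2) (# 0) (λ ()) ∷ []) ∷ (H-≢ (# 3) (# 0) (λ ()) ∷ []) ∷ [] ∷ []

    rotated-C₄ : table A (b₁ ∷ a₂ ∷ b₂ ∷ a₁ ∷ []) ≡ C₄ᵗ
    rotated-C₄ = table₄ G (C₄-adj (# 1) (# 2)) (C₄-adj (# 1) (# 3)) (C₄-adj (# 1) (# 0))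
                          (C₄-adj (# 2) (# 3)) (C₄-adj (# 2) (# 0)) (C₄-adj (# 3) (# 0))

    rotated-∉ : ∀ {y} → y ∈ᵇ H ≡ false → y ∈ᵇ (b₁ ∷ a₂ ∷ b₂ ∷ a₁ ∷ []) ≡ false
    rotated-∉ {y} y∉ with ∉ᵇ⇒All≢ {x = y} H y∉
    ... | y≢a₁ ∷ y≢b₁ ∷ y≢a₂ ∷ y≢b₂ ∷ [] rewrite ==-≢ y≢a₁ | ==-≢ y≢b₁ | ==-≢ y≢a₂ | ==-≢ y≢b₂ = refl

    rotated-row : ∀ {y} → map (A y) H ≡ (false ∷ true ∷ false ∷ true ∷ []) →
      map (A y) (b₁ ∷ a₂ ∷ b₂ ∷ a₁ ∷ []) ≡ (true ∷ false ∷ true ∷ false ∷ [])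
    rotated-row r = cong₂ _∷_ (row-entry r (# 1)) (cong₂ _∷_ (row-entry r (# 2))
                      (cong₂ _∷_ (row-entry r (# 3)) (cong₂ _∷_ (row-entry r (# 0)) refl)))

  C₄-impossible : ∀ {a₁ b₁ a₂ b₂} → Unique (a₁ ∷ b₁ ∷ a₂ ∷ b₂ ∷ []) →
    table A (a₁ ∷ b₁ ∷ a₂ ∷ b₂ ∷ []) ≡ C₄ᵗ →
    ¬ Iso A W4 → ¬ Iso A E2∨C4 → ¬ (∀ l → 2 ≤ l → ¬ Iso A (K2l l))
  C₄-impossible {a₁} {b₁} {a₂} {b₂} H! H-C₄ ¬W4 ¬E2∨C4 ¬K2l
    with any? (λ y → y ∈ᵇ (a₁ ∷ b₁ ∷ a₂ ∷ b₂ ∷ []) Bool.≟ false)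
  ... | no none = ¬Iso-by (# 0 ∷ # 2 ∷ # 1 ∷ # 3 ∷ []) (# 0 ∷ # 2 ∷ # 1 ∷ # 3 ∷ []) refl (¬K2l 2 (s≤s (s≤s z≤n)))
                    (Iso-table G H! (covering {W = a₁ ∷ b₁ ∷ a₂ ∷ b₂ ∷ []} none) H-C₄)
  ... | yes (y₀ , y₀∉) = by-row (map (A y₀) H) refl (row-type y₀∉) (attached y₀∉)
    where
    open C₄-Case H! H-C₄
    by-row : ∀ r → map (A y₀) H ≡ r → C₄-rowᵇ r ≡ true → or r ≡ true → ⊥
    by-row (true ∷ false ∷ true ∷ false ∷ []) r₀ _ _ = hubs-a y₀∉ r₀ ¬K2l
    by-row (false ∷ true ∷ false ∷ true ∷ []) r₀ _ _ =
      C₄-Case.hubs-a rotated-unique rotated-C₄ {y₀} (rotated-∉ {y₀} y₀∉) (rotated-row r₀) ¬K2l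
    by-row (true ∷ true ∷ true ∷ true ∷ []) r₀ _ _ = wheel y₀∉ r₀ ¬W4 ¬E2∨C4
    by-row (false ∷ false ∷ false ∷ false ∷ []) _ _ ()
    by-row (true ∷ true ∷ true ∷ false ∷ []) _ () _
    by-row (true ∷ true ∷ false ∷ true ∷ []) _ () _
    by-row (true ∷ true ∷ false ∷ false ∷ []) _ () _
    by-row (true ∷ false ∷ true ∷ true ∷ []) _ () _
    by-row (true ∷ false ∷ false ∷ true ∷ []) _ () _
    by-row (true ∷ false ∷ false ∷ false ∷ []) _ () _
    by-row (false ∷ true ∷ true ∷ true ∷ []) _ () _
    by-row (false ∷ true ∷ true ∷ false ∷ []) _ () _
    by-row (false ∷ true ∷ false ∷ false ∷ []) _ () _
    by-row (false ∷ false ∷ true ∷ true ∷ []) _ () _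
    by-row (false ∷ false ∷ true ∷ false ∷ []) _ () _
    by-row (false ∷ false ∷ false ∷ true ∷ []) _ () _

  no-obstruction : ¬ Iso A W4 → ¬ Iso A E2∨C4 → ¬ Iso A P5 → ¬ Iso A Hammer → ¬ Iso A Butterfly →
    (∀ l → 2 ≤ l → ¬ Iso A (K2l l)) → ¬ Obstruction A
  no-obstruction _ _ ¬P5 ¬Hammer ¬Butterfly _ (induced-2K₂ {_ ∷ _ ∷ _ ∷ _ ∷ []} H! H-2K₂) =
    2K₂-Case.impossible H! H-2K₂ ¬P5 ¬Hammer ¬Butterfly
  no-obstruction ¬W4 ¬E2∨C4 _ _ _ ¬K2l (induced-C₄ {_ ∷ _ ∷ _ ∷ _ ∷ []} H! H-C₄) =
    C₄-impossible H! H-C₄ ¬W4 ¬E2∨C4 ¬K2l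
  no-obstruction _ _ _ _ _ _ (induced-C₅ H! H-C₅) = no-bad-induced H! H-C₅ refl

theorem2p8 : (n : ℕ) (G : SimpleGraph n) → Connected (adj G) → NotExcluded (adj G) →
    (IsSplit (adj G) → ∀ (u v : Fin n) → adj G u v ≡ true → IsSplit (contract (adj G) u v)) ×
    ((∀ (u v : Fin n) → adj G u v ≡ true → IsSplit (contract (adj G) u v)) → IsSplit (adj G))
theorem2p8 zero G _ _ = (λ _ ()) , λ _ → (λ ()) , (λ ()) , (λ ())
theorem2p8 (suc N) G connected (¬K2l , ¬W4 , ¬E2∨C4 , _ , ¬P5 , ¬Hammer , ¬Butterfly) =
  IsSplit⇒AllContractionsSplit (adj G) (irrefl G) , split-by-contractions
  where
  split-by-contractions : AllContractionsSplit (adj G) → IsSplit (adj G)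
  split-by-contractions split =
    [ id , ⊥-elim ∘ Elimination.no-obstruction G connected split ¬W4 ¬E2∨C4 ¬P5 ¬Hammer ¬Butterfly ¬K2l ]′
      (FöldesHammer.split-or-obstruction G)
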